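{- Let $(M,\in_1,\in_2)\models ZFC(\in_1)\cup ZFC(\in_2)$ and let $x,y,f\in M$ satisfy $\psi(x,y,f)$. Then: (a) if $x'\in_1 x$, then $\phi(x',f(x'))$; (b) if $y'\in_2 y$, then there is $x'\in_1 x$ such that $f(x')=y'$ and $\phi(x',y')$.
   Context: $ZFC(\in_1)$ denotes the first-order ZFC axioms with $\in_1$ as membership relation, where formulas in the schemas (Separation, Replacement) may contain both $\in_1$ and $\in_2$; $ZFC(\in_2)$ is symmetric. For $i=1,2$, $\mathrm{tr}_i(x)$ is the formula $\forall t\in_i x\,\forall w\in_i t\,(w\in_i x)$. $\mathrm{TC}_i(x)$ denotes the unique $u$ such that $\mathrm{tr}_i(u)$, $\forall v\in_i x\,(v\in_i u)$, and for every $v$ with $\mathrm{tr}_i(v)\wedge\forall w\in_i x\,(w\in_i v)$ we have $\forall w\in_i u\,(w\in_i v)$ (the $\in_i$-transitive closure of $x$); in $\mathrm{TC}_i(\{x\})$, $\{x\}$ is the singleton in the sense of $\in_i$. $\psi(x,y,f)$ is the conjunction of: (i) in the sense of $\in_1$, $f$ is a function with domain $\mathrm{TC}_1(\{x\})$; (ii) $\forall t\in_1\mathrm{TC}_1(x)\,(f(t)\in_2\mathrm{TC}_2(y))$; (iii) $\forall t\in_2\mathrm{TC}_2(y)\,\exists w\in_1\mathrm{TC}_1(x)\,(t=f(w))$; (iv) $\forall t\in_1\mathrm{TC}_1(x)\,\forall w\in_1\mathrm{TC}_1(\{x\})\,(t\in_1 w\leftrightarrow f(t)\in_2 f(w))$;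 (v) $f(x)=y$. Function application $f(t)$ is in the sense of $\in_1$. $\phi(x,y)$ is the formula $\exists f\,\psi(x,y,f)$. -}

module Defs where

open import Data.Nat using (ℕ; zero; suc)
open import Data.Fin using (Fin; zero; suc)
open import Data.Product using (Σ; _×_; _,_)
open import Data.Sum using (_⊎_)
open import Data.Empty using (⊥)
open import Relation.Nullary using (¬_)
open import Relation.Binary.PropositionalEquality using (_≡_)

_↔_ : Set → Set → Set
A ↔ B = (A → B) × (B → A)

-- First-order formulas in the language {∈₁, ∈₂, =} (de Bruijn variables)

data Fm : ℕ → Set where
  _∈₁_ : ∀ {n} → Fin n → Fin n → Fm n
  _∈₂_ : ∀ {n} → Fin n → Fin n → Fm n
  _≐_  : ∀ {n} → Fin n → Fin n → Fm n
  ⊥'   : ∀ {n} → Fm n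
  _⇒_  : ∀ {n} → Fm n → Fm n → Fm n
  ∀'   : ∀ {n} → Fm (suc n) → Fm n

cons : {M : Set} {n : ℕ} → M → (Fin n → M) → Fin (suc n) → M
cons a ρ zero    = a
cons a ρ (suc i) = ρ i

Sat : {M : Set} (E₁ E₂ : M → M → Set) {n : ℕ} → Fm n → (Fin n → M) → Set
Sat E₁ E₂ (i ∈₁ j) ρ = E₁ (ρ i) (ρ j)
Sat E₁ E₂ (i ∈₂ j) ρ = E₂ (ρ i) (ρ j)
Sat E₁ E₂ (i ≐ j)  ρ = ρ i ≡ ρ j
Sat E₁ E₂ ⊥'       ρ = ⊥
Sat E₁ E₂ (φ ⇒ χ)  ρ = Sat E₁ E₂ φ ρ → Sat E₁ E₂ χ ρ
Sat {M} E₁ E₂ (∀' φ) ρ = (a : M) → Sat E₁ E₂ φ (cons a ρ)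

-- ZFC(E) where E ∈ {E₁, E₂} is the membership relation and the schemas
-- range over all formulas of the two-relation language {∈₁, ∈₂}.

record ZFC {M : Set} (E₁ E₂ : M → M → Set) (E : M → M → Set) : Set₁ where
  field
    extensionality : ∀ a b → (∀ z → E z a ↔ E z b) → a ≡ b
    foundation     : ∀ a → Σ M (λ z → E z a) →
                     Σ M (λ z → E z a × (∀ w → E w z → ¬ E w a))
    pairing        : ∀ a b → Σ M (λ c → E a c × E b c)
    union          : ∀ a → Σ M (λ u → ∀ z w → E z a → E w z → E w u)
    powerset       : ∀ a → Σ M (λ p → ∀ z → (∀ w → E w z → E w a) → E z p)
    infinity       : Σ M (λ I → Σ M (λ e → E e I × (∀ w → ¬ E w e))
                       × (∀ z → E z I → Σ M (λ s → E s I ×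
                              (∀ w → E w s ↔ (E w z ⊎ w ≡ z)))))
    separation     : ∀ {k} (φ : Fm (suc k)) (ps : Fin k → M) (a : M) →
                     Σ M (λ b → ∀ z → E z b ↔ (E z a × Sat E₁ E₂ φ (cons z ps)))
    replacement    : ∀ {k} (φ : Fm (suc (suc k))) (ps : Fin k → M) (a : M) →
                     (∀ x → E x a →
                        Σ M (λ y → Sat E₁ E₂ φ (cons x (cons y ps)) ×
                          (∀ y' → Sat E₁ E₂ φ (cons x (cons y' ps)) → y' ≡ y))) →
                     Σ M (λ b → ∀ x → E x a →
                        Σ M (λ y → E y b × Sat E₁ E₂ φ (cons x (cons y ps))))
    choice         : ∀ a → (∀ z → E z a → Σ M (λ w → E w z)) →
                     (∀ z z' → E z a → E z' a → ¬ (z ≡ z') →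
                        ∀ w → E w z → ¬ E w z') →
                     Σ M (λ c → ∀ z → E z a →
                        Σ M (λ w → (E w z × E w c) ×
                          (∀ w' → E w' z → E w' c → w' ≡ w)))

module SetNotions {M : Set} (E : M → M → Set) where

  Tr : M → Set
  Tr x = ∀ t w → E t x → E w t → E w x

  IsTC : M → M → Set
  IsTC x u = Tr u × (∀ v → E v x → E v u) ×
             (∀ v → Tr v → (∀ w → E w x → E w v) → ∀ w → E w u → E w v)

  InTC : M → M → Set
  InTC x t = Σ M (λ u → IsTC x u × E t u)

  IsSing : M → M → Set
  IsSing a s = ∀ z → E z s ↔ (z ≡ a)

  IsUPair : M → M → M → Set
  IsUPair a b s = ∀ z → E z s ↔ (z ≡ a ⊎ z ≡ b)

  IsOPair : M → M → M → Set
  IsOPair a b p = ∀ z → E z p ↔ (IsSing a z ⊎ IsUPair a b z)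

  InTCSing : M → M → Set
  InTCSing x t = Σ M (λ s → IsSing x s × InTC s t)

  App : M → M → M → Set
  App f t v = Σ M (λ p → IsOPair t v p × E p f)

  IsFunOn : M → (M → Set) → Set
  IsFunOn f D =
    (∀ p → E p f → Σ M (λ a → Σ M (λ b → IsOPair a b p × D a))) ×
    (∀ a → D a → Σ M (λ b → App f a b × (∀ b' → App f a b' → b' ≡ b)))

module Iso {M : Set} (E₁ E₂ : M → M → Set) where
  module S₁ = SetNotions E₁
  module S₂ = SetNotions E₂

  ψ : M → M → M → Set
  ψ x y f =
    S₁.IsFunOn f (S₁.InTCSing x) ×
    (∀ t → S₁.InTC x t → Σ M (λ v → S₁.App f t v × S₂.InTC y v)) ×
    (∀ t → S₂.InTC y t → Σ M (λ w → S₁.InTC x w × S₁.App f w t)) ×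
    (∀ t w ft fw → S₁.InTC x t → S₁.InTCSing x w →
       S₁.App f t ft → S₁.App f w fw → (E₁ t w ↔ E₂ ft fw)) ×
    S₁.App f x y

  φ : M → M → Set
  φ x y = Σ M (λ f → ψ x y f)

-- Let W = TC₁({x'}) and let g be the restriction of f to W.  Everything in
-- ψ(x', f(x'), g) is inherited from ψ(x, y, f) except that g maps TC₁(x')
-- onto TC₂(f(x')).  Both inclusions follow by ∈-induction inside the two
-- transitive closures, which is available because the Separation schema of
-- each theory may mention the other membership relation.  Part (b) reduces
-- to part (a), since (iii) and (iv) give y' = f(x') for some x' ∈₁ x.
-- The transitive closures involved exist in ZFC(∈ᵢ) as ⋃ {⋃ⁿ a | n ∈ ω},
-- obtained from Infinity and Replacement.
module Submission where

open import Defs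
open import Data.Product using (Σ; _×_; _,_; proj₁; proj₂)
open import Data.Sum using (_⊎_; inj₁; inj₂; [_,_]′; fromInj₁)
open import Data.Empty using (⊥-elim)
open import Data.Nat using (suc)
open import Data.Fin using (Fin; zero; suc; #_; _↑ʳ_)
open import Function using (const; _∘_)
open import Relation.Nullary using (¬_)
open import Relation.Binary.PropositionalEquality using (_≡_; refl; sym; trans; subst)
open import Level using (0ℓ)
open import Axiom.ExcludedMiddle using (ExcludedMiddle)
open import Axiom.DoubleNegationElimination using (em⇒dne)

↔-refl : {P : Set} → P ↔ P
↔-refl = (λ p → p) , (λ p → p)

↔-sym : {P Q : Set} → P ↔ Q → Q ↔ P
↔-sym (f , g) = g , f

↔-trans : {P Q R : Set} → P ↔ Q → Q ↔ R → P ↔ R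
↔-trans (f , g) (h , k) = (λ p → h (f p)) , (λ r → g (k r))

→-cong : {P P' Q Q' : Set} → P ↔ P' → Q ↔ Q' → (P → Q) ↔ (P' → Q')
→-cong (f , g) (h , k) = (λ u p → h (u (g p))) , (λ u p → k (u (f p)))

×-cong : {P P' Q Q' : Set} → P ↔ P' → Q ↔ Q' → (P × Q) ↔ (P' × Q')
×-cong (f , g) (h , k) = (λ (p , q) → f p , h q) , (λ (p , q) → g p , k q)

⊎-cong : {P P' Q Q' : Set} → P ↔ P' → Q ↔ Q' → (P ⊎ Q) ↔ (P' ⊎ Q')
⊎-cong (f , g) (h , k) = (λ { (inj₁ p) → inj₁ (f p) ; (inj₂ q) → inj₂ (h q) })
                       , (λ { (inj₁ p) → inj₁ (g p) ; (inj₂ q) → inj₂ (k q) })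

↔-cong : {P P' Q Q' : Set} → P ↔ P' → Q ↔ Q' → (P ↔ Q) ↔ (P' ↔ Q')
↔-cong e e' = ×-cong (→-cong e e') (→-cong e' e)

Π-cong : {A : Set} {P Q : A → Set} →
         (∀ a → P a ↔ Q a) → ((a : A) → P a) ↔ ((a : A) → Q a)
Π-cong h = (λ u a → proj₁ (h a) (u a)) , (λ u a → proj₂ (h a) (u a))

Σ-cong : {A : Set} {P Q : A → Set} → (∀ a → P a ↔ Q a) → Σ A P ↔ Σ A Q
Σ-cong h = (λ (a , p) → a , proj₁ (h a) p) , (λ (a , q) → a , proj₂ (h a) q)

¬' : ∀ {n} → Fm n → Fm n
¬' A = A ⇒ ⊥'

_∧'_ : ∀ {n} → Fm n → Fm n → Fm n
A ∧' B = ¬' (A ⇒ ¬' B)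

_∨'_ : ∀ {n} → Fm n → Fm n → Fm n
A ∨' B = ¬' A ⇒ B

_⇔'_ : ∀ {n} → Fm n → Fm n → Fm n
A ⇔' B = (A ⇒ B) ∧' (B ⇒ A)

∃' : ∀ {n} → Fm (suc n) → Fm n
∃' A = ¬' (∀' (¬' A))

module Classical {M : Set} (E₁ E₂ : M → M → Set) (lem : ExcludedMiddle 0ℓ) where

  ⟦_⟧ : ∀ {n} → Fm n → (Fin n → M) → Set
  ⟦_⟧ = Sat E₁ E₂

  private
    dne : {P : Set} → ¬ ¬ P → P
    dne = em⇒dne lem

  Sat-∧' : ∀ {n} (A B : Fm n) {ρ} → ⟦ A ∧' B ⟧ ρ ↔ (⟦ A ⟧ ρ × ⟦ B ⟧ ρ)
  Sat-∧' A B = (λ h → dne (λ ¬a → h (λ a → ⊥-elim (¬a a))) , dne (λ ¬b → h (λ _ → ¬b)))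
             , λ (a , b) k → k a b

  Sat-∨' : ∀ {n} (A B : Fm n) {ρ} → ⟦ A ∨' B ⟧ ρ ↔ (⟦ A ⟧ ρ ⊎ ⟦ B ⟧ ρ)
  Sat-∨' A B = (λ h → dne (λ ¬a⊎b → ¬a⊎b (inj₂ (h (λ a → ¬a⊎b (inj₁ a))))))
             , (λ { (inj₁ a) ¬a → ⊥-elim (¬a a) ; (inj₂ b) _ → b })

  Sat-⇔' : ∀ {n} (A B : Fm n) {ρ} → ⟦ A ⇔' B ⟧ ρ ↔ (⟦ A ⟧ ρ ↔ ⟦ B ⟧ ρ)
  Sat-⇔' A B = Sat-∧' (A ⇒ B) (B ⇒ A)

  Sat-∃' : ∀ {n} (A : Fm (suc n)) {ρ} → ⟦ ∃' A ⟧ ρ ↔ Σ M λ a → ⟦ A ⟧ (cons a ρ)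
  Sat-∃' A = (λ h → dne (λ ¬∃ → h (λ a s → ¬∃ (a , s)))) , (λ (a , s) k → k a s)

  Sat-∃'∧' : ∀ {n} (A B : Fm (suc n)) {ρ} →
             ⟦ ∃' (A ∧' B) ⟧ ρ ↔ Σ M λ a → ⟦ A ⟧ (cons a ρ) × ⟦ B ⟧ (cons a ρ)
  Sat-∃'∧' A B = ↔-trans (Sat-∃' (A ∧' B)) (Σ-cong λ _ → Sat-∧' A B)

module MoreSetNotions {M : Set} (E : M → M → Set) where
  open SetNotions E

  _⊆_ : M → M → Set
  a ⊆ b = ∀ w → E w a → E w b

  IsEmpty : M → Set
  IsEmpty e = ∀ w → ¬ E w e

  IsSucc : M → M → Set
  IsSucc j k = ∀ w → E w k ↔ (E w j ⊎ w ≡ j)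

  IsUnion : M → M → Set
  IsUnion s t = ∀ w → E w t ↔ Σ M (λ c → E c s × E w c)

  IsRestriction : M → M → M → Set
  IsRestriction f W g =
    ∀ p → E p g ↔ (E p f × Σ M λ a → Σ M λ b → IsOPair a b p × E a W)

  -- A union chain from a is (the graph of) an initial segment of the
  -- recursion k ↦ ⋃ᵏ a along the finite von Neumann ordinals, so that
  -- IsIterUnion a k s says s = ⋃ᵏ a.
  IsStart : M → M → Set
  IsStart a p = Σ M λ e → IsEmpty e × IsOPair e a p

  IsUnionStep : M → M → Set
  IsUnionStep g p = Σ M λ j → Σ M λ s → Σ M λ k → Σ M λ t →
    App g j s × (IsSucc j k × (IsUnion s t × IsOPair k t p))

  UnionChain : M → M → Set
  UnionChain a g = ∀ p → E p g → IsStart a p ⊎ IsUnionStep g p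

  IsIterUnion : M → M → M → Set
  IsIterUnion a k s = Σ M λ g → UnionChain a g × App g k s

  IterUnionUnique : M → M → Set
  IterUnionUnique a k = ∀ s s' → IsIterUnion a k s → IsIterUnion a k s' → s ≡ s'

  IterUnionDefined : M → M → Set
  IterUnionDefined a k = Σ M (IsIterUnion a k) × IterUnionUnique a k

module Definable {M : Set} (E₁ E₂ : M → M → Set) (lem : ExcludedMiddle 0ℓ)
  (E : M → M → Set) (_∈ᶠ_ : ∀ {n} → Fin n → Fin n → Fm n)
  (Sat-∈ᶠ : ∀ {n} {i j : Fin n} {ρ} → Sat E₁ E₂ (i ∈ᶠ j) ρ ↔ E (ρ i) (ρ j))
  where
  open Classical E₁ E₂ lem
  open SetNotions E
  open MoreSetNotions E

  IsSingᶠ : ∀ {n} → Fin n → Fin n → Fm n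
  IsSingᶠ a s = ∀' ((zero ∈ᶠ suc s) ⇔' (zero ≐ suc a))

  Sat-IsSingᶠ : ∀ {n} (a s : Fin n) {ρ} → ⟦ IsSingᶠ a s ⟧ ρ ↔ IsSing (ρ a) (ρ s)
  Sat-IsSingᶠ a s = Π-cong λ _ →
    ↔-trans (Sat-⇔' (zero ∈ᶠ suc s) (zero ≐ suc a)) (↔-cong Sat-∈ᶠ ↔-refl)

  IsUPairᶠ : ∀ {n} → Fin n → Fin n → Fin n → Fm n
  IsUPairᶠ a b s = ∀' ((zero ∈ᶠ suc s) ⇔' ((zero ≐ suc a) ∨' (zero ≐ suc b)))

  Sat-IsUPairᶠ : ∀ {n} (a b s : Fin n) {ρ} →
                 ⟦ IsUPairᶠ a b s ⟧ ρ ↔ IsUPair (ρ a) (ρ b) (ρ s)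
  Sat-IsUPairᶠ a b s {ρ} = Π-cong λ z →
    ↔-trans (Sat-⇔' (zero ∈ᶠ suc s) ((zero ≐ suc a) ∨' (zero ≐ suc b)))
            (↔-cong Sat-∈ᶠ (Sat-∨' (zero ≐ suc a) (zero ≐ suc b) {cons z ρ}))

  IsOPairᶠ : ∀ {n} → Fin n → Fin n → Fin n → Fm n
  IsOPairᶠ a b p =
    ∀' ((zero ∈ᶠ suc p) ⇔' (IsSingᶠ (suc a) zero ∨' IsUPairᶠ (suc a) (suc b) zero))

  Sat-IsOPairᶠ : ∀ {n} (a b p : Fin n) {ρ} →
                 ⟦ IsOPairᶠ a b p ⟧ ρ ↔ IsOPair (ρ a) (ρ b) (ρ p)
  Sat-IsOPairᶠ a b p = Π-cong λ _ →
    ↔-trans (Sat-⇔' (zero ∈ᶠ suc p)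
                    (IsSingᶠ (suc a) zero ∨' IsUPairᶠ (suc a) (suc b) zero))
      (↔-cong Sat-∈ᶠ
        (↔-trans (Sat-∨' (IsSingᶠ (suc a) zero) (IsUPairᶠ (suc a) (suc b) zero))
                 (⊎-cong (Sat-IsSingᶠ (suc a) zero) (Sat-IsUPairᶠ (suc a) (suc b) zero))))

  Trᶠ : ∀ {n} → Fin n → Fm n
  Trᶠ u =
    ∀' (∀' (((# 1) ∈ᶠ suc (suc u)) ⇒ ((zero ∈ᶠ (# 1)) ⇒ (zero ∈ᶠ suc (suc u)))))

  Sat-Trᶠ : ∀ {n} (u : Fin n) {ρ} → ⟦ Trᶠ u ⟧ ρ ↔ Tr (ρ u)
  Sat-Trᶠ u = Π-cong λ _ → Π-cong λ _ → →-cong Sat-∈ᶠ (→-cong Sat-∈ᶠ Sat-∈ᶠ)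

  Appᶠ : ∀ {n} → Fin n → Fin n → Fin n → Fm n
  Appᶠ f t v = ∃' (IsOPairᶠ (suc t) (suc v) zero ∧' (zero ∈ᶠ suc f))

  Sat-Appᶠ : ∀ {n} (f t v : Fin n) {ρ} → ⟦ Appᶠ f t v ⟧ ρ ↔ App (ρ f) (ρ t) (ρ v)
  Sat-Appᶠ f t v =
    ↔-trans (Sat-∃'∧' (IsOPairᶠ (suc t) (suc v) zero) (zero ∈ᶠ suc f))
            (Σ-cong λ _ → ×-cong (Sat-IsOPairᶠ (suc t) (suc v) zero) Sat-∈ᶠ)

  IsEmptyᶠ : ∀ {n} → Fin n → Fm n
  IsEmptyᶠ e = ∀' (¬' (zero ∈ᶠ suc e))

  Sat-IsEmptyᶠ : ∀ {n} (e : Fin n) {ρ} → ⟦ IsEmptyᶠ e ⟧ ρ ↔ IsEmpty (ρ e)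
  Sat-IsEmptyᶠ e = Π-cong λ _ → →-cong Sat-∈ᶠ ↔-refl

  IsSuccᶠ : ∀ {n} → Fin n → Fin n → Fm n
  IsSuccᶠ j k = ∀' ((zero ∈ᶠ suc k) ⇔' ((zero ∈ᶠ suc j) ∨' (zero ≐ suc j)))

  Sat-IsSuccᶠ : ∀ {n} (j k : Fin n) {ρ} → ⟦ IsSuccᶠ j k ⟧ ρ ↔ IsSucc (ρ j) (ρ k)
  Sat-IsSuccᶠ j k = Π-cong λ _ →
    ↔-trans (Sat-⇔' (zero ∈ᶠ suc k) ((zero ∈ᶠ suc j) ∨' (zero ≐ suc j)))
      (↔-cong Sat-∈ᶠ (↔-trans (Sat-∨' (zero ∈ᶠ suc j) (zero ≐ suc j))
                               (⊎-cong Sat-∈ᶠ ↔-refl)))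

  IsUnionᶠ : ∀ {n} → Fin n → Fin n → Fm n
  IsUnionᶠ s t =
    ∀' ((zero ∈ᶠ suc t) ⇔' ∃' ((zero ∈ᶠ suc (suc s)) ∧' ((# 1) ∈ᶠ zero)))

  Sat-IsUnionᶠ : ∀ {n} (s t : Fin n) {ρ} → ⟦ IsUnionᶠ s t ⟧ ρ ↔ IsUnion (ρ s) (ρ t)
  Sat-IsUnionᶠ s t = Π-cong λ _ →
    ↔-trans (Sat-⇔' (zero ∈ᶠ suc t)
                    (∃' ((zero ∈ᶠ suc (suc s)) ∧' ((# 1) ∈ᶠ zero))))
      (↔-cong Sat-∈ᶠ (↔-trans (Sat-∃'∧' (zero ∈ᶠ suc (suc s)) ((# 1) ∈ᶠ zero))
                               (Σ-cong λ _ → ×-cong Sat-∈ᶠ Sat-∈ᶠ)))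

  IsStartᶠ : ∀ {n} → Fin n → Fin n → Fm n
  IsStartᶠ a p = ∃' (IsEmptyᶠ zero ∧' IsOPairᶠ zero (suc a) (suc p))

  Sat-IsStartᶠ : ∀ {n} (a p : Fin n) {ρ} → ⟦ IsStartᶠ a p ⟧ ρ ↔ IsStart (ρ a) (ρ p)
  Sat-IsStartᶠ a p =
    ↔-trans (Sat-∃'∧' (IsEmptyᶠ zero) (IsOPairᶠ zero (suc a) (suc p)))
            (Σ-cong λ _ → ×-cong (Sat-IsEmptyᶠ zero) (Sat-IsOPairᶠ zero (suc a) (suc p)))

  IsUnionStepᶠ : ∀ {n} → Fin n → Fin n → Fm n
  IsUnionStepᶠ {n} g p = ∃' (∃' (∃' (∃' body)))
    where
    body : Fm (suc (suc (suc (suc n))))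
    body = Appᶠ (4 ↑ʳ g) (# 3) (# 2) ∧'
           (IsSuccᶠ (# 3) (# 1) ∧'
           (IsUnionᶠ (# 2) zero ∧'
            IsOPairᶠ (# 1) zero (4 ↑ʳ p)))

  Sat-IsUnionStepᶠ : ∀ {n} (g p : Fin n) {ρ} →
                     ⟦ IsUnionStepᶠ g p ⟧ ρ ↔ IsUnionStep (ρ g) (ρ p)
  Sat-IsUnionStepᶠ {n} g p =
    ↔-trans (Sat-∃' (∃' (∃' (∃' (A ∧' (B ∧' (C ∧' D))))))) (Σ-cong λ _ →
    ↔-trans (Sat-∃' (∃' (∃' (A ∧' (B ∧' (C ∧' D)))))) (Σ-cong λ _ →
    ↔-trans (Sat-∃' (∃' (A ∧' (B ∧' (C ∧' D))))) (Σ-cong λ _ →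
    ↔-trans (Sat-∃' (A ∧' (B ∧' (C ∧' D)))) (Σ-cong λ _ →
    ↔-trans (Sat-∧' A (B ∧' (C ∧' D))) (×-cong (Sat-Appᶠ (4 ↑ʳ g) (# 3) (# 2))
    (↔-trans (Sat-∧' B (C ∧' D)) (×-cong (Sat-IsSuccᶠ (# 3) (# 1))
    (↔-trans (Sat-∧' C D) (×-cong (Sat-IsUnionᶠ (# 2) zero)
                                  (Sat-IsOPairᶠ (# 1) zero (4 ↑ʳ p)))))))))))
    where
    A B C D : Fm (suc (suc (suc (suc n))))
    A = Appᶠ (4 ↑ʳ g) (# 3) (# 2)
    B = IsSuccᶠ (# 3) (# 1)
    C = IsUnionᶠ (# 2) zero
    D = IsOPairᶠ (# 1) zero (4 ↑ʳ p)

  UnionChainᶠ : ∀ {n} → Fin n → Fin n → Fm n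
  UnionChainᶠ a g =
    ∀' ((zero ∈ᶠ suc g) ⇒ (IsStartᶠ (suc a) zero ∨' IsUnionStepᶠ (suc g) zero))

  Sat-UnionChainᶠ : ∀ {n} (a g : Fin n) {ρ} →
                    ⟦ UnionChainᶠ a g ⟧ ρ ↔ UnionChain (ρ a) (ρ g)
  Sat-UnionChainᶠ a g = Π-cong λ _ → →-cong Sat-∈ᶠ
    (↔-trans (Sat-∨' (IsStartᶠ (suc a) zero) (IsUnionStepᶠ (suc g) zero))
             (⊎-cong (Sat-IsStartᶠ (suc a) zero) (Sat-IsUnionStepᶠ (suc g) zero)))

  IsIterUnionᶠ : ∀ {n} → Fin n → Fin n → Fin n → Fm n
  IsIterUnionᶠ a k s = ∃' (UnionChainᶠ (suc a) zero ∧' Appᶠ zero (suc k) (suc s))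

  Sat-IsIterUnionᶠ : ∀ {n} (a k s : Fin n) {ρ} →
                     ⟦ IsIterUnionᶠ a k s ⟧ ρ ↔ IsIterUnion (ρ a) (ρ k) (ρ s)
  Sat-IsIterUnionᶠ a k s =
    ↔-trans (Sat-∃'∧' (UnionChainᶠ (suc a) zero) (Appᶠ zero (suc k) (suc s)))
            (Σ-cong λ _ → ×-cong (Sat-UnionChainᶠ (suc a) zero)
                                 (Sat-Appᶠ zero (suc k) (suc s)))

  IterUnionUniqueᶠ : ∀ {n} → Fin n → Fin n → Fm n
  IterUnionUniqueᶠ a k =
    ∀' (∀' (IsIterUnionᶠ (suc (suc a)) (suc (suc k)) (# 1) ⇒
            (IsIterUnionᶠ (suc (suc a)) (suc (suc k)) zero ⇒ ((# 1) ≐ zero))))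

  Sat-IterUnionUniqueᶠ : ∀ {n} (a k : Fin n) {ρ} →
                         ⟦ IterUnionUniqueᶠ a k ⟧ ρ ↔ IterUnionUnique (ρ a) (ρ k)
  Sat-IterUnionUniqueᶠ a k = Π-cong λ _ → Π-cong λ _ →
    →-cong (Sat-IsIterUnionᶠ (suc (suc a)) (suc (suc k)) (# 1))
           (→-cong (Sat-IsIterUnionᶠ (suc (suc a)) (suc (suc k)) zero) ↔-refl)

  IterUnionDefinedᶠ : ∀ {n} → Fin n → Fin n → Fm n
  IterUnionDefinedᶠ a k = ∃' (IsIterUnionᶠ (suc a) (suc k) zero) ∧' IterUnionUniqueᶠ a k

  Sat-IterUnionDefinedᶠ : ∀ {n} (a k : Fin n) {ρ} →
                          ⟦ IterUnionDefinedᶠ a k ⟧ ρ ↔ IterUnionDefined (ρ a) (ρ k)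
  Sat-IterUnionDefinedᶠ a k =
    ↔-trans (Sat-∧' (∃' (IsIterUnionᶠ (suc a) (suc k) zero)) (IterUnionUniqueᶠ a k))
      (×-cong (↔-trans (Sat-∃' (IsIterUnionᶠ (suc a) (suc k) zero))
                       (Σ-cong λ _ → Sat-IsIterUnionᶠ (suc a) (suc k) zero))
              (Sat-IterUnionUniqueᶠ a k))

module ZFCFacts {M : Set} (E₁ E₂ : M → M → Set) (lem : ExcludedMiddle 0ℓ)
  (E : M → M → Set) (_∈ᶠ_ : ∀ {n} → Fin n → Fin n → Fm n)
  (Sat-∈ᶠ : ∀ {n} {i j : Fin n} {ρ} → Sat E₁ E₂ (i ∈ᶠ j) ρ ↔ E (ρ i) (ρ j))
  (Z : ZFC E₁ E₂ E) where
  open ZFC Z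
  open SetNotions E
  open MoreSetNotions E
  open Classical E₁ E₂ lem
  open Definable E₁ E₂ lem E _∈ᶠ_ Sat-∈ᶠ public

  separation↔ : ∀ {k} (φ : Fm (suc k)) (ps : Fin k → M) {P : M → Set} →
                (∀ z → ⟦ φ ⟧ (cons z ps) ↔ P z) →
                ∀ a → Σ M λ b → ∀ z → E z b ↔ (E z a × P z)
  separation↔ φ ps φ↔P a =
    let b , b-spec = separation φ ps a
    in b , λ z → ↔-trans (b-spec z) (×-cong ↔-refl (φ↔P z))

  set-of : ∀ {k} (φ : Fm (suc k)) (ps : Fin k → M) {P : M → Set} →
           (∀ z → ⟦ φ ⟧ (cons z ps) ↔ P z) →
           ∀ a → (∀ z → P z → E z a) → Σ M λ b → ∀ z → E z b ↔ P z
  set-of φ ps φ↔P a P⊆a =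
    let b , b-spec = separation↔ φ ps φ↔P a
    in b , λ z → (λ z∈b → proj₂ (proj₁ (b-spec z) z∈b))
               , (λ Pz → proj₂ (b-spec z) (P⊆a z Pz , Pz))

  replacement↔ : ∀ {k} (φ : Fm (suc (suc k))) (ps : Fin k → M) {R : M → M → Set} →
                 (∀ x y → ⟦ φ ⟧ (cons x (cons y ps)) ↔ R x y) →
                 ∀ a → (∀ x → E x a → Σ M λ y → R x y × (∀ y' → R x y' → y' ≡ y)) →
                 Σ M λ b → ∀ x → E x a → Σ M λ y → E y b × R x y
  replacement↔ φ ps φ↔R a functional =
    let b , b-spec = replacement φ ps a λ x x∈a →
          let y , r , unique = functional x x∈a
          in y , proj₂ (φ↔R x y) r , λ y' r' → unique y' (proj₁ (φ↔R x y') r')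
    in b , λ x x∈a → let y , y∈b , r = b-spec x x∈a in y , y∈b , proj₁ (φ↔R x y) r

  same-members : ∀ {a b} {P : M → Set} →
                 (∀ w → E w a ↔ P w) → (∀ w → E w b ↔ P w) → a ≡ b
  same-members a-spec b-spec = extensionality _ _ λ w → ↔-trans (a-spec w) (↔-sym (b-spec w))

  ≡↔same-members : ∀ {s} {P : M → Set} → (∀ w → E w s ↔ P w) →
                   ∀ z → (z ≡ s) ↔ (∀ w → E w z ↔ P w)
  ≡↔same-members s-spec z = (λ z≡s → subst (λ r → ∀ w → E w r ↔ _) (sym z≡s) s-spec)
                          , (λ z-spec → same-members z-spec s-spec)

  singleton : ∀ a → Σ M (IsSing a)
  singleton a =
    let c , a∈c , _ = pairing a a
    in set-of {k = 1} (zero ≐ (# 1)) (const a) (λ _ → ↔-refl) c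
         λ z z≡a → subst (λ r → E r c) (sym z≡a) a∈c

  upair : ∀ a b → Σ M (IsUPair a b)
  upair a b =
    let c , a∈c , b∈c = pairing a b
    in set-of {k = 2} ((zero ≐ (# 1)) ∨' (zero ≐ (# 2))) (cons a (const b))
         (λ z → Sat-∨' {n = 3} (zero ≐ (# 1)) (zero ≐ (# 2)) {cons z (cons a (const b))}) c
         λ z → [ (λ z≡a → subst (λ r → E r c) (sym z≡a) a∈c)
               , (λ z≡b → subst (λ r → E r c) (sym z≡b) b∈c) ]′

  opair : ∀ a b → Σ M (IsOPair a b)
  opair a b =
    let s₁ , s₁-spec = singleton a
        s₂ , s₂-spec = upair a b
        p , p-spec = upair s₁ s₂
    in p , λ z → ↔-trans (p-spec z)
                         (⊎-cong (≡↔same-members s₁-spec z) (≡↔same-members s₂-spec z))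

  opair-injectiveˡ : ∀ {a b a' b' p} → IsOPair a b p → IsOPair a' b' p → a ≡ a'
  opair-injectiveˡ {a} op op' with singleton a
  ... | s , s-spec with proj₁ (op' s) (proj₂ (op s) (inj₁ s-spec))
  ... | inj₁ s-single = proj₁ (s-single a) (proj₂ (s-spec a) refl)
  ... | inj₂ s-pair   = sym (proj₁ (s-spec _) (proj₂ (s-pair _) (inj₁ refl)))

  private
    opair-second : ∀ {a b b' p} → IsOPair a b p → IsOPair a b' p → b ≡ a ⊎ b ≡ b'
    opair-second {a} {b} op op' with upair a b
    ... | u , u-spec with proj₁ (op' u) (proj₂ (op u) (inj₂ u-spec))
    ... | inj₁ u-single = inj₁ (proj₁ (u-single b) (proj₂ (u-spec b) (inj₂ refl)))
    ... | inj₂ u-pair   = proj₁ (u-pair b) (proj₂ (u-spec b) (inj₂ refl))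

  opair-injectiveʳ : ∀ {a b b' p} → IsOPair a b p → IsOPair a b' p → b ≡ b'
  opair-injectiveʳ op op' with opair-second op op' | opair-second op' op
  ... | inj₂ b≡b' | _         = b≡b'
  ... | _         | inj₂ b'≡b = sym b'≡b
  ... | inj₁ b≡a  | inj₁ b'≡a = trans b≡a (sym b'≡a)

  opair-injective : ∀ {a b a' b' p} → IsOPair a b p → IsOPair a' b' p → a ≡ a' × b ≡ b'
  opair-injective op op' with opair-injectiveˡ op op'
  ... | refl = refl , opair-injectiveʳ op op'

  union-set : ∀ a → Σ M (IsUnion a)
  union-set a =
    let U , U-spec = union a
    in set-of {k = 1} (∃' ((zero ∈ᶠ (# 2)) ∧' ((# 1) ∈ᶠ zero))) (const a)
         (λ _ → ↔-trans (Sat-∃'∧' (zero ∈ᶠ (# 2)) ((# 1) ∈ᶠ zero))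
                        (Σ-cong λ _ → ×-cong Sat-∈ᶠ Sat-∈ᶠ))
         U λ w (c , c∈a , w∈c) → U-spec c w c∈a w∈c

  union-unique : ∀ {s t t'} → IsUnion s t → IsUnion s t' → t ≡ t'
  union-unique = same-members

  adjoin : ∀ g q → Σ M λ h → ∀ w → E w h ↔ (E w g ⊎ w ≡ q)
  adjoin g q =
    let s , s-spec = singleton q
        P , P-spec = upair g s
        h , h-spec = union-set P
    in h , λ w → ↔-trans (h-spec w)
         ( (λ (c , c∈P , w∈c) →
              [ (λ c≡g → inj₁ (subst (E w) c≡g w∈c))
              , (λ c≡s → inj₂ (proj₁ (s-spec w) (subst (E w) c≡s w∈c))) ]′
              (proj₁ (P-spec c) c∈P))
         , [ (λ w∈g → g , proj₂ (P-spec g) (inj₁ refl) , w∈g)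
           , (λ w≡q → s , proj₂ (P-spec s) (inj₂ refl) , proj₂ (s-spec w) w≡q) ]′ )

  ∈-asym : ∀ {a b} → E a b → ¬ E b a
  ∈-asym {a} {b} a∈b b∈a with upair a b
  ... | P , P-spec with foundation P (a , proj₂ (P-spec a) (inj₁ refl))
  ... | z , z∈P , z-minimal with proj₁ (P-spec z) z∈P
  ... | inj₁ refl = z-minimal b b∈a (proj₂ (P-spec b) (inj₂ refl))
  ... | inj₂ refl = z-minimal a a∈b (proj₂ (P-spec a) (inj₁ refl))

  succ-injective : ∀ {j j' k} → IsSucc j k → IsSucc j' k → j ≡ j'
  succ-injective j⁺≡k j'⁺≡k = em⇒dne lem λ j≢j' →
    ∈-asym (∈-other j⁺≡k j'⁺≡k j≢j') (∈-other j'⁺≡k j⁺≡k (j≢j' ∘ sym))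
    where
    ∈-other : ∀ {i i' k} → IsSucc i k → IsSucc i' k → ¬ i ≡ i' → E i i'
    ∈-other i⁺≡k i'⁺≡k i≢i' =
      fromInj₁ (⊥-elim ∘ i≢i') (proj₁ (i'⁺≡k _) (proj₂ (i⁺≡k _) (inj₂ refl)))

  IsTC-least : ∀ {a u v} → IsTC a u → Tr v → a ⊆ v → u ⊆ v
  IsTC-least (_ , _ , least) = least _

  TC-within : ∀ {a u} → Tr u → a ⊆ u → Σ M (IsTC a)
  TC-within {a} {u} u-transitive a⊆u with separation↔ φ (const a) φ↔P u
    where
    φ : Fm 2
    φ = ∀' (Trᶠ zero ⇒ (∀' ((zero ∈ᶠ (# 3)) ⇒ (zero ∈ᶠ (# 1))) ⇒ ((# 1) ∈ᶠ zero)))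
    φ↔P : ∀ t → ⟦ φ ⟧ (cons t (const a)) ↔ (∀ v → Tr v → a ⊆ v → E t v)
    φ↔P _ = Π-cong λ _ →
      →-cong (Sat-Trᶠ zero) (→-cong (Π-cong λ _ → →-cong Sat-∈ᶠ Sat-∈ᶠ) Sat-∈ᶠ)
  ... | T , ∈T = T , T-transitive , a⊆T , T-least
    where
    T-transitive : Tr T
    T-transitive t w t∈T w∈t =
      let t∈u , t∈every = proj₁ (∈T t) t∈T
      in proj₂ (∈T w) ( u-transitive t w t∈u w∈t
                      , λ v v-transitive a⊆v → v-transitive t w (t∈every v v-transitive a⊆v) w∈t)
    a⊆T : a ⊆ T
    a⊆T w w∈a = proj₂ (∈T w) (a⊆u w w∈a , λ _ _ a⊆v → a⊆v w w∈a)
    T-least : ∀ v → Tr v → a ⊆ v → T ⊆ v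
    T-least v v-transitive a⊆v t t∈T = proj₂ (proj₁ (∈T t) t∈T) v v-transitive a⊆v

  iterUnion-zero : ∀ {a e} → IsEmpty e → IsIterUnion a e a
  iterUnion-zero {a} {e} e-empty =
    let p , p-spec = opair e a
        g , g-spec = singleton p
    in g , (λ q q∈g → inj₁ (e , e-empty , subst (IsOPair e a) (sym (proj₁ (g-spec q) q∈g)) p-spec))
         , p , p-spec , proj₂ (g-spec p) refl

  iterUnion-zero-unique : ∀ {a e s} → IsEmpty e → IsIterUnion a e s → s ≡ a
  iterUnion-zero-unique e-empty (g , chain , p , p-spec , p∈g) with chain p p∈g
  ... | inj₁ (_ , _ , p-spec') = proj₂ (opair-injective p-spec p-spec')
  ... | inj₂ (j , _ , _ , _ , _ , j⁺≡k , _ , p-spec') =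
    let e≡k = proj₁ (opair-injective p-spec p-spec')
    in ⊥-elim (e-empty j (subst (E j) (sym e≡k) (proj₂ (j⁺≡k j) (inj₂ refl))))

  iterUnion-suc : ∀ {a k k' s t} →
                  IsIterUnion a k s → IsSucc k k' → IsUnion s t → IsIterUnion a k' t
  iterUnion-suc {a} {k} {k'} {s} {t} (g , chain , k↦s) k⁺≡k' ⋃s≡t with opair k' t
  ... | p , p-spec with adjoin g p
  ... | g' , g'-spec = g' , chain' , p , p-spec , proj₂ (g'-spec p) (inj₂ refl)
    where
    widen : ∀ {i r} → App g i r → App g' i r
    widen (q , q-spec , q∈g) = q , q-spec , proj₂ (g'-spec q) (inj₁ q∈g)
    chain' : UnionChain a g'
    chain' q q∈g' with proj₁ (g'-spec q) q∈g'
    ... | inj₂ refl = inj₂ (k , s , k' , t , widen k↦s , k⁺≡k' , ⋃s≡t , p-spec)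
    ... | inj₁ q∈g with chain q q∈g
    ...   | inj₁ start = inj₁ start
    ...   | inj₂ (j , r , i , u , j↦r , step) = inj₂ (j , r , i , u , widen j↦r , step)

  iterUnion-pred : ∀ {a k k' t} → IsSucc k k' → IsIterUnion a k' t →
                   Σ M λ s → IsIterUnion a k s × IsUnion s t
  iterUnion-pred {k = k} k⁺≡k' (g , chain , p , p-spec , p∈g) with chain p p∈g
  ... | inj₁ (e , e-empty , p-spec') =
    let k'≡e = proj₁ (opair-injective p-spec p-spec')
    in ⊥-elim (e-empty k (subst (E k) k'≡e (proj₂ (k⁺≡k' k) (inj₂ refl))))
  ... | inj₂ (j , s , i , u , j↦s , j⁺≡i , ⋃s≡u , p-spec')
      with opair-injective p-spec p-spec'
  ...   | refl , refl =
    s , (g , chain , subst (λ r → App g r s) (succ-injective j⁺≡i k⁺≡k') j↦s) , ⋃s≡u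

  iterUnion-defined-zero : ∀ {a e} → IsEmpty e → IterUnionDefined a e
  iterUnion-defined-zero e-empty =
    (_ , iterUnion-zero e-empty) , λ _ _ e↦s e↦s' →
      trans (iterUnion-zero-unique e-empty e↦s) (sym (iterUnion-zero-unique e-empty e↦s'))

  iterUnion-defined-suc : ∀ {a k k'} →
                          IterUnionDefined a k → IsSucc k k' → IterUnionDefined a k'
  iterUnion-defined-suc ((s , k↦s) , unique) k⁺≡k' =
    let t , ⋃s≡t = union-set s
    in (t , iterUnion-suc k↦s k⁺≡k' ⋃s≡t) , λ t₁ t₂ k'↦t₁ k'↦t₂ →
         let s₁ , k↦s₁ , ⋃s₁≡t₁ = iterUnion-pred k⁺≡k' k'↦t₁
             s₂ , k↦s₂ , ⋃s₂≡t₂ = iterUnion-pred k⁺≡k' k'↦t₂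
         in union-unique (subst (λ r → IsUnion r t₁) (unique s₁ s₂ k↦s₁ k↦s₂) ⋃s₁≡t₁) ⋃s₂≡t₂

  -- T = ⋃ {⋃ᵏ a | k ∈ D}, where D ⊆ I collects the k at which ⋃ᵏ a is defined.
  -- D is closed under successor, so T is transitive without any induction on ω.
  module IterUnionSuperset (a I e : M) (e∈I : E e I) (e-empty : IsEmpty e)
                           (I-suc : ∀ k → E k I → Σ M λ k' → E k' I × IsSucc k k') where

    defined-stages : Σ M λ D → ∀ k → E k D ↔ (E k I × IterUnionDefined a k)
    defined-stages =
      separation↔ {k = 1} (IterUnionDefinedᶠ (# 1) zero) (const a)
                  (λ _ → Sat-IterUnionDefinedᶠ (# 1) zero) I

    D : M
    D = proj₁ defined-stages

    ∈D : ∀ k → E k D ↔ (E k I × IterUnionDefined a k)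
    ∈D = proj₂ defined-stages

    stage-values : Σ M λ B → ∀ k → E k D → Σ M λ s → E s B × IsIterUnion a k s
    stage-values =
      replacement↔ {k = 1} (IsIterUnionᶠ (# 2) zero (# 1)) (const a)
                   (λ _ _ → Sat-IsIterUnionᶠ (# 2) zero (# 1)) D
        λ k k∈D → let (s , k↦s) , unique = proj₂ (proj₁ (∈D k) k∈D)
                  in s , k↦s , λ s' k↦s' → unique s' s k↦s' k↦s

    B : M
    B = proj₁ stage-values

    stage-value : ∀ k → E k D → Σ M λ s → E s B × IsIterUnion a k s
    stage-value = proj₂ stage-values

    iterates : Σ M λ V → ∀ s → E s V ↔ (E s B × Σ M λ k → E k D × IsIterUnion a k s)
    iterates =
      separation↔ {k = 2} (∃' ((zero ∈ᶠ (# 2)) ∧' IsIterUnionᶠ (# 3) zero (# 1)))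
                  (cons D (const a))
                  (λ _ → ↔-trans (Sat-∃'∧' (zero ∈ᶠ (# 2)) (IsIterUnionᶠ (# 3) zero (# 1)))
                                 (Σ-cong λ _ → ×-cong Sat-∈ᶠ (Sat-IsIterUnionᶠ (# 3) zero (# 1))))
                  B

    V : M
    V = proj₁ iterates

    ∈V : ∀ s → E s V ↔ (E s B × Σ M λ k → E k D × IsIterUnion a k s)
    ∈V = proj₂ iterates

    T : M
    T = proj₁ (union-set V)

    ∈T : IsUnion V T
    ∈T = proj₂ (union-set V)

    a⊆T : a ⊆ T
    a⊆T w w∈a =
      let e∈D = proj₂ (∈D e) (e∈I , iterUnion-defined-zero e-empty)
          s , s∈B , e↦s = stage-value e e∈D
          s∈V = proj₂ (∈V s) (s∈B , e , e∈D , e↦s)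
      in proj₂ (∈T w) (a , subst (λ r → E r V) (iterUnion-zero-unique e-empty e↦s) s∈V , w∈a)

    T-transitive : Tr T
    T-transitive t w t∈T w∈t =
      let c , c∈V , t∈c = proj₁ (∈T t) t∈T
          _ , k , k∈D , k↦c = proj₁ (∈V c) c∈V
          k∈I , k-defined = proj₁ (∈D k) k∈D
          k' , k'∈I , k⁺≡k' = I-suc k k∈I
          k'-defined = iterUnion-defined-suc k-defined k⁺≡k'
          k'∈D = proj₂ (∈D k') (k'∈I , k'-defined)
          s , s∈B , k'↦s = stage-value k' k'∈D
          u , ⋃c≡u = union-set c
          s≡u = proj₂ k'-defined s u k'↦s (iterUnion-suc k↦c k⁺≡k' ⋃c≡u)
      in proj₂ (∈T w) ( s , proj₂ (∈V s) (s∈B , k' , k'∈D , k'↦s)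
                      , subst (E w) (sym s≡u) (proj₂ (⋃c≡u w) (t , t∈c , w∈t)))

  transitive-superset : ∀ a → Σ M λ u → Tr u × a ⊆ u
  transitive-superset a with infinity
  ... | I , (e , e∈I , e-empty) , I-suc = T , T-transitive , a⊆T
    where open IterUnionSuperset a I e e∈I e-empty I-suc

  tc : ∀ a → Σ M (IsTC a)
  tc a = let u , u-transitive , a⊆u = transitive-superset a in TC-within u-transitive a⊆u

  TC : M → M
  TC a = proj₁ (tc a)

  TC-isTC : ∀ a → IsTC a (TC a)
  TC-isTC a = proj₂ (tc a)

  TC-transitive : ∀ a → Tr (TC a)
  TC-transitive a = proj₁ (TC-isTC a)

  ⊆TC : ∀ a → a ⊆ TC a
  ⊆TC a = proj₁ (proj₂ (TC-isTC a))

  TC-least : ∀ {a v} → Tr v → a ⊆ v → TC a ⊆ v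
  TC-least = IsTC-least (TC-isTC _)

  InTC↔∈TC : ∀ {a t} → InTC a t ↔ E t (TC a)
  InTC↔∈TC {a} = (λ (_ , u-tc , t∈u) → IsTC-least u-tc (TC-transitive a) (⊆TC a) _ t∈u)
               , (λ t∈TC → TC a , TC-isTC a , t∈TC)

  TCSing : M → M
  TCSing a = TC (proj₁ (singleton a))

  TCSing-transitive : ∀ a → Tr (TCSing a)
  TCSing-transitive a = TC-transitive (proj₁ (singleton a))

  ∈TCSing : ∀ a → E a (TCSing a)
  ∈TCSing a = ⊆TC (proj₁ (singleton a)) a (proj₂ (proj₂ (singleton a) a) refl)

  TCSing-least : ∀ {a v} → Tr v → E a v → TCSing a ⊆ v
  TCSing-least {a} v-transitive a∈v = TC-least v-transitive λ w w∈sa →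
    subst (λ r → E r _) (sym (proj₁ (proj₂ (singleton a) w) w∈sa)) a∈v

  TC⊆TCSing : ∀ a → TC a ⊆ TCSing a
  TC⊆TCSing a = TC-least (TCSing-transitive a) λ w w∈a →
    TCSing-transitive a a w (∈TCSing a) w∈a

  InTCSing↔∈TCSing : ∀ {a t} → InTCSing a t ↔ E t (TCSing a)
  InTCSing↔∈TCSing {a} =
    (λ (s , s-single , u , u-tc , t∈u) →
       IsTC-least u-tc (TCSing-transitive a)
         (λ w w∈s → subst (λ r → E r (TCSing a)) (sym (proj₁ (s-single w) w∈s)) (∈TCSing a))
         _ t∈u)
    , (λ t∈TCSing → proj₁ (singleton a) , proj₂ (singleton a) , proj₂ InTC↔∈TC t∈TCSing)

  IsTC-induction : ∀ {k} (φ : Fm (suc k)) (ps : Fin k → M) {P : M → Set} →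
                   (∀ z → ⟦ φ ⟧ (cons z ps) ↔ P z) → ∀ {a U} → IsTC a U →
                   (∀ w → E w a → P w) → (∀ t w → E t U → P t → E w t → P w) →
                   ∀ t → E t U → P t
  IsTC-induction φ ps φ↔P {a} {U} U-tc base step with separation↔ φ ps φ↔P U
  ... | S , ∈S = λ t t∈U → proj₂ (proj₁ (∈S t) (IsTC-least U-tc S-transitive a⊆S t t∈U))
    where
    S-transitive : Tr S
    S-transitive t w t∈S w∈t =
      let t∈U , Pt = proj₁ (∈S t) t∈S
      in proj₂ (∈S w) (proj₁ U-tc t w t∈U w∈t , step t w t∈U Pt w∈t)
    a⊆S : a ⊆ S
    a⊆S w w∈a = proj₂ (∈S w) (proj₁ (proj₂ U-tc) w w∈a , base w w∈a)

  restriction : ∀ f W → Σ M (IsRestriction f W)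
  restriction f W =
    separation↔ {k = 1} (∃' (∃' (pair ∧' first∈W))) (const W)
      (λ _ → ↔-trans (Sat-∃' (∃' (pair ∧' first∈W))) (Σ-cong λ _ →
             ↔-trans (Sat-∃'∧' pair first∈W)
                     (Σ-cong λ _ → ×-cong (Sat-IsOPairᶠ (# 1) zero (# 2)) Sat-∈ᶠ)))
      f
    where
    pair first∈W : Fm 4
    pair = IsOPairᶠ (# 1) zero (# 2)
    first∈W = (# 1) ∈ᶠ (# 3)

  App-restriction : ∀ {f W g} → IsRestriction f W g →
                    ∀ {t b} → App g t b ↔ (App f t b × E t W)
  App-restriction {W = W} g-spec =
    (λ (p , p-spec , p∈g) →
       let p∈f , _ , _ , p-spec' , a∈W = proj₁ (g-spec p) p∈g
           t≡a = proj₁ (opair-injective p-spec p-spec')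
       in (p , p-spec , p∈f) , subst (λ r → E r W) (sym t≡a) a∈W)
    , (λ ((p , p-spec , p∈f) , t∈W) →
         p , p-spec , proj₂ (g-spec p) (p∈f , _ , _ , p-spec , t∈W))

module Isomorphism (lem : ExcludedMiddle 0ℓ) {M : Set} {E₁ E₂ : M → M → Set}
  (Z₁ : ZFC E₁ E₂ E₁) (Z₂ : ZFC E₁ E₂ E₂) {x y f : M} (hψ : Iso.ψ E₁ E₂ x y f) where
  open Classical E₁ E₂ lem
  open SetNotions E₁
  module ZF₁ = ZFCFacts E₁ E₂ lem E₁ _∈₁_ ↔-refl Z₁
  module ZF₂ = ZFCFacts E₁ E₂ lem E₂ _∈₂_ ↔-refl Z₂
  open ZF₁ using (TC; TCSing; TC-transitive; ⊆TC; TC⊆TCSing; InTC↔∈TC; InTCSing↔∈TCSing)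
  open MoreSetNotions E₁ using (_⊆_; IsRestriction)
  open MoreSetNotions E₂ using () renaming (_⊆_ to _⊆₂_)

  f-total : ∀ {a} → E₁ a (TCSing x) → Σ M (App f a)
  f-total a∈ =
    let b , fa≡b , _ = proj₂ (proj₁ hψ) _ (proj₂ InTCSing↔∈TCSing a∈)
    in b , fa≡b

  f-functional : ∀ {a b b'} → E₁ a (TCSing x) → App f a b → App f a b' → b ≡ b'
  f-functional a∈ fa≡b fa≡b' =
    let _ , _ , unique = proj₂ (proj₁ hψ) _ (proj₂ InTCSing↔∈TCSing a∈)
    in trans (unique _ fa≡b) (sym (unique _ fa≡b'))

  f-into : ∀ {t} → E₁ t (TC x) → Σ M λ v → App f t v × E₂ v (ZF₂.TC y)
  f-into t∈ =
    let v , ft≡v , v∈ = proj₁ (proj₂ hψ) _ (proj₂ InTC↔∈TC t∈)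
    in v , ft≡v , proj₁ ZF₂.InTC↔∈TC v∈

  f-onto : ∀ {s} → E₂ s (ZF₂.TC y) → Σ M λ w → E₁ w (TC x) × App f w s
  f-onto s∈ =
    let w , w∈ , fw≡s = proj₁ (proj₂ (proj₂ hψ)) _ (proj₂ ZF₂.InTC↔∈TC s∈)
    in w , proj₁ InTC↔∈TC w∈ , fw≡s

  f-iso : ∀ {t w ft fw} → E₁ t (TC x) → E₁ w (TCSing x) →
          App f t ft → App f w fw → E₁ t w ↔ E₂ ft fw
  f-iso t∈ w∈ =
    proj₁ (proj₂ (proj₂ (proj₂ hψ))) _ _ _ _ (proj₂ InTC↔∈TC t∈) (proj₂ InTCSing↔∈TCSing w∈)

  fx≡y : App f x y
  fx≡y = proj₂ (proj₂ (proj₂ (proj₂ hψ)))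

  ImageIn : M → M → Set
  ImageIn V t = Σ M λ b → App f t b × E₂ b V

  ImageInᶠ : Fm 3
  ImageInᶠ = ∃' (ZF₁.Appᶠ (# 2) (# 1) zero ∧' (zero ∈₂ (# 3)))

  Sat-ImageInᶠ : ∀ V t → ⟦ ImageInᶠ ⟧ (cons t (cons f (const V))) ↔ ImageIn V t
  Sat-ImageInᶠ V t =
    ↔-trans (Sat-∃'∧' {n = 3} (ZF₁.Appᶠ (# 2) (# 1) zero) (zero ∈₂ (# 3))
                      {cons t (cons f (const V))})
            (Σ-cong λ b → ×-cong (ZF₁.Sat-Appᶠ {n = 4} (# 2) (# 1) zero
                                              {cons b (cons t (cons f (const V)))})
                                 ↔-refl)

  PreimageIn : M → M → Set
  PreimageIn W s = Σ M λ w → App f w s × E₁ w W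

  PreimageInᶠ : Fm 3
  PreimageInᶠ = ∃' (ZF₁.Appᶠ (# 2) zero (# 1) ∧' (zero ∈₁ (# 3)))

  Sat-PreimageInᶠ : ∀ W s → ⟦ PreimageInᶠ ⟧ (cons s (cons f (const W))) ↔ PreimageIn W s
  Sat-PreimageInᶠ W s =
    ↔-trans (Sat-∃'∧' {n = 3} (ZF₁.Appᶠ (# 2) zero (# 1)) (zero ∈₁ (# 3))
                      {cons s (cons f (const W))})
            (Σ-cong λ w → ×-cong (ZF₁.Sat-Appᶠ {n = 4} (# 2) zero (# 1)
                                              {cons w (cons s (cons f (const W)))})
                                 ↔-refl)

  module Restriction {x'} (x'∈x : E₁ x' x) where

    x'∈TCx : E₁ x' (TC x)
    x'∈TCx = ⊆TC x x' x'∈x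

    x'∈TCSingx : E₁ x' (TCSing x)
    x'∈TCSingx = TC⊆TCSing x x' x'∈TCx

    v : M
    v = proj₁ (f-into x'∈TCx)

    fx'≡v : App f x' v
    fx'≡v = proj₁ (proj₂ (f-into x'∈TCx))

    TCx'⊆TCx : TC x' ⊆ TC x
    TCx'⊆TCx = ZF₁.TC-least (TC-transitive x) λ w w∈x' → TC-transitive x x' w x'∈TCx w∈x'

    TCSingx'⊆TCSingx : TCSing x' ⊆ TCSing x
    TCSingx'⊆TCSingx = ZF₁.TCSing-least (ZF₁.TCSing-transitive x) x'∈TCSingx

    TCv⊆TCy : ZF₂.TC v ⊆₂ ZF₂.TC y
    TCv⊆TCy = ZF₂.TC-least (ZF₂.TC-transitive y) λ w w∈v →
      ZF₂.TC-transitive y v w (proj₂ (proj₂ (f-into x'∈TCx))) w∈v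

    maps-into : ∀ t → E₁ t (TC x') → ImageIn (ZF₂.TC v) t
    maps-into = ZF₁.IsTC-induction ImageInᶠ (cons f (const (ZF₂.TC v)))
                                   (Sat-ImageInᶠ (ZF₂.TC v)) (ZF₁.TC-isTC x') base step
      where
      base : ∀ w → E₁ w x' → ImageIn (ZF₂.TC v) w
      base w w∈x' =
        let w∈TCx = TC-transitive x x' w x'∈TCx w∈x'
            b , fw≡b , _ = f-into w∈TCx
        in b , fw≡b , ZF₂.⊆TC v b (proj₁ (f-iso w∈TCx x'∈TCSingx fw≡b fx'≡v) w∈x')
      step : ∀ t w → E₁ t (TC x') → ImageIn (ZF₂.TC v) t → E₁ w t → ImageIn (ZF₂.TC v) w
      step t w t∈TCx' (b , ft≡b , b∈TCv) w∈t =
        let w∈TCx = TCx'⊆TCx w (TC-transitive x' t w t∈TCx' w∈t)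
            t∈TCSingx = TC⊆TCSing x t (TCx'⊆TCx t t∈TCx')
            b' , fw≡b' , _ = f-into w∈TCx
            b'∈b = proj₁ (f-iso w∈TCx t∈TCSingx fw≡b' ft≡b) w∈t
        in b' , fw≡b' , ZF₂.TC-transitive v b b' b∈TCv b'∈b

    maps-onto : ∀ s → E₂ s (ZF₂.TC v) → PreimageIn (TC x') s
    maps-onto = ZF₂.IsTC-induction PreimageInᶠ (cons f (const (TC x')))
                                   (Sat-PreimageInᶠ (TC x')) (ZF₂.TC-isTC v) base step
      where
      base : ∀ s → E₂ s v → PreimageIn (TC x') s
      base s s∈v =
        let w , w∈TCx , fw≡s = f-onto (TCv⊆TCy s (ZF₂.⊆TC v s s∈v))
        in w , fw≡s , ⊆TC x' w (proj₂ (f-iso w∈TCx x'∈TCSingx fw≡s fx'≡v) s∈v)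
      step : ∀ s r → E₂ s (ZF₂.TC v) → PreimageIn (TC x') s → E₂ r s → PreimageIn (TC x') r
      step s r s∈TCv (w , fw≡s , w∈TCx') r∈s =
        let w' , w'∈TCx , fw'≡r = f-onto (TCv⊆TCy r (ZF₂.TC-transitive v s r s∈TCv r∈s))
            w∈TCSingx = TC⊆TCSing x w (TCx'⊆TCx w w∈TCx')
            w'∈w = proj₂ (f-iso w'∈TCx w∈TCSingx fw'≡r fw≡s) r∈s
        in w' , fw'≡r , TC-transitive x' w w' w∈TCx' w'∈w

    g : M
    g = proj₁ (ZF₁.restriction f (TCSing x'))

    g-spec : IsRestriction f (TCSing x') g
    g-spec = proj₂ (ZF₁.restriction f (TCSing x'))

    App-g : ∀ {t b} → App g t b ↔ (App f t b × E₁ t (TCSing x'))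
    App-g = ZF₁.App-restriction g-spec

    ψ-g : Iso.ψ E₁ E₂ x' v g
    ψ-g = (graph , total) , into , onto , iso , proj₂ App-g (fx'≡v , ZF₁.∈TCSing x')
      where
      graph : ∀ p → E₁ p g → Σ M λ a → Σ M λ b → IsOPair a b p × InTCSing x' a
      graph p p∈g =
        let _ , a , b , p-spec , a∈ = proj₁ (g-spec p) p∈g
        in a , b , p-spec , proj₂ InTCSing↔∈TCSing a∈
      total : ∀ a → InTCSing x' a → Σ M λ b → App g a b × (∀ b' → App g a b' → b' ≡ b)
      total a a∈ =
        let a∈TCSingx' = proj₁ InTCSing↔∈TCSing a∈
            a∈TCSingx = TCSingx'⊆TCSingx a a∈TCSingx'
            b , fa≡b = f-total a∈TCSingx
        in b , proj₂ App-g (fa≡b , a∈TCSingx')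
             , λ b' ga≡b' → f-functional a∈TCSingx (proj₁ (proj₁ App-g ga≡b')) fa≡b
      into : ∀ t → InTC x' t → Σ M λ b → App g t b × SetNotions.InTC E₂ v b
      into t t∈ =
        let t∈TCx' = proj₁ InTC↔∈TC t∈
            b , ft≡b , b∈ = maps-into t t∈TCx'
        in b , proj₂ App-g (ft≡b , TC⊆TCSing x' t t∈TCx') , proj₂ ZF₂.InTC↔∈TC b∈
      onto : ∀ s → SetNotions.InTC E₂ v s → Σ M λ w → InTC x' w × App g w s
      onto s s∈ =
        let w , fw≡s , w∈TCx' = maps-onto s (proj₁ ZF₂.InTC↔∈TC s∈)
        in w , proj₂ InTC↔∈TC w∈TCx' , proj₂ App-g (fw≡s , TC⊆TCSing x' w w∈TCx')
      iso : ∀ t w ft fw → InTC x' t → InTCSing x' w →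
            App g t ft → App g w fw → E₁ t w ↔ E₂ ft fw
      iso t w ft fw t∈ w∈ gt≡ft gw≡fw =
        f-iso (TCx'⊆TCx t (proj₁ InTC↔∈TC t∈)) (TCSingx'⊆TCSingx w (proj₁ InTCSing↔∈TCSing w∈))
              (proj₁ (proj₁ App-g gt≡ft)) (proj₁ (proj₁ App-g gw≡fw))

  image-φ : ∀ x' → E₁ x' x → Σ M λ v → App f x' v × Iso.φ E₁ E₂ x' v
  image-φ x' x'∈x = v , fx'≡v , g , ψ-g
    where open Restriction x'∈x

  preimage-φ : ∀ y' → E₂ y' y → Σ M λ x' → E₁ x' x × App f x' y' × Iso.φ E₁ E₂ x' y'
  preimage-φ y' y'∈y =
    let x' , x'∈TCx , fx'≡y' = f-onto (ZF₂.⊆TC y y' y'∈y)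
        x'∈x = proj₂ (f-iso x'∈TCx (ZF₁.∈TCSing x) fx'≡y' fx≡y) y'∈y
        v , fx'≡v , φx'v = image-φ x' x'∈x
        v≡y' = f-functional (TC⊆TCSing x x' x'∈TCx) fx'≡v fx'≡y'
    in x' , x'∈x , fx'≡y' , subst (Iso.φ E₁ E₂ x') v≡y' φx'v

lemma2 : ExcludedMiddle 0ℓ →
    (M : Set) (E₁ E₂ : M → M → Set) →
    ZFC E₁ E₂ E₁ → ZFC E₁ E₂ E₂ →
    (x y f : M) → Iso.ψ E₁ E₂ x y f →
    ((x' : M) → E₁ x' x →
       Σ M (λ v → SetNotions.App E₁ f x' v × Iso.φ E₁ E₂ x' v)) ×
    ((y' : M) → E₂ y' y →
       Σ M (λ x' → E₁ x' x × SetNotions.App E₁ f x' y' × Iso.φ E₁ E₂ x' y'))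
lemma2 lem M E₁ E₂ Z₁ Z₂ x y f hψ = image-φ , preimage-φ
  where open Isomorphism lem Z₁ Z₂ hψ
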